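{- Let $G=(V,E)$ be a finite connected undirected multigraph without self-loops, let $\eta^*$ be the optimal density for $\mathrm{Mod}_2(\Phi)$, let $E_{\max}=\{e\in E:\eta^*(e)=\max_{e'\in E}\eta^*(e')\}$, and let $P_{\max}$ be the Beurling partition of $G$ with cut set $E_{P_{\max}}=E_{\max}$ (such a partition exists). If $P$ is any critical partition of $G$, then $P_{\max}$ is finer than $P$.
   Context: A feasible partition of $V$ is a partition $P=\{V_1,\dots,V_{k_P}\}$, $k_P\ge2$, with each induced subgraph $G(V_i)$ connected; its cut set $E_P$ is the set of edges joining different parts. $\Phi$ is the family of feasible partitions with usage vectors $\frac{1}{k_P-1}\mathbb{1}_{E_P}$; $\mathrm{Adm}(\Phi)=\{\eta\in\mathbb{R}^E_{\ge0}:\frac{1}{k_P-1}\sum_{e\in E_P}\eta(e)\ge1\ \forall P\in\Phi\}$; $\eta^*$ is the unique minimizer of $\sum_e\eta(e)^2$ on $\mathrm{Adm}(\Phi)$. $P$ is a Beurling partition if $\sum_{e\in E_P}\eta^*(e)=k_P-1$. The strength is $S(G)=\min_P\frac{|E_P|}{k_P-1}$ over feasible partitions; a critical partition is a feasible partition attaining this minimum. $P$ is finer than $P'$ if every element of $P'$ is a union of elements of $P$. -}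

module Defs where

open import Data.Nat as ℕ using (ℕ; zero; suc; _∸_)
open import Data.Fin using (Fin; zero; suc)
open import Data.Fin.Properties using () renaming (_≟_ to _≟ᶠ_)
open import Data.Product using (Σ; _×_; _,_; proj₁; proj₂; ∃)
open import Data.Integer using (+_)
open import Data.Rational using (ℚ; 0ℚ; _+_; _*_; _≤_; _/_)
open import Relation.Binary.PropositionalEquality using (_≡_; _≢_)
open import Relation.Nullary using (¬_; yes; no)
open import Function.Bundles using (_⇔_)

record Multigraph : Set where
  field
    n    : ℕ
    m    : ℕ
    ends : Fin m → Fin n × Fin n
    noLoops : (e : Fin m) → proj₁ (ends e) ≢ proj₂ (ends e)

module _ (G : Multigraph) where
  open Multigraph G

  Joins : Fin m → Fin n → Fin n → Set
  Joins e u v = (ends e ≡ (u , v)) Data.Sum.⊎ (ends e ≡ (v , u))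
    where import Data.Sum

  -- walks from u to v staying inside the vertex set S (u, v ∈ S assumed by caller)
  data WalkIn (S : Fin n → Set) : Fin n → Fin n → Set where
    here : ∀ {u} → WalkIn S u u
    step : ∀ {u w v} (e : Fin m) → Joins e u w → S w → WalkIn S w v → WalkIn S u v

  InducedConnected : (Fin n → Set) → Set
  InducedConnected S = ∀ u v → S u → S v → WalkIn S u v

  Connected : Set
  Connected = ∀ u v → WalkIn (λ _ → Data.Unit.⊤) u v
    where import Data.Unit

  record FeasiblePartition : Set where
    field
      k        : ℕ
      label    : Fin n → Fin k
      two≤k    : 2 ℕ.≤ k
      nonempty : (i : Fin k) → ∃ λ v → label v ≡ i
      partConn : (i : Fin k) → InducedConnected (λ v → label v ≡ i)

  open FeasiblePartition public

  InCut : FeasiblePartition → Fin m → Set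
  InCut P e = label P (proj₁ (ends e)) ≢ label P (proj₂ (ends e))

  sumℚ : ∀ {j} → (Fin j → ℚ) → ℚ
  sumℚ {zero}  f = 0ℚ
  sumℚ {suc j} f = f zero + sumℚ (λ i → f (suc i))

  sumℕ : ∀ {j} → (Fin j → ℕ) → ℕ
  sumℕ {zero}  f = 0
  sumℕ {suc j} f = f zero ℕ.+ sumℕ (λ i → f (suc i))

  cutSum : FeasiblePartition → (Fin m → ℚ) → ℚ
  cutSum P η = sumℚ λ e → cutTerm e
    where
    cutTerm : Fin m → ℚ
    cutTerm e with label P (proj₁ (ends e)) ≟ᶠ label P (proj₂ (ends e))
    ... | yes _ = 0ℚ
    ... | no  _ = η e

  cutSize : FeasiblePartition → ℕ
  cutSize P = sumℕ λ e → cutInd e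
    where
    cutInd : Fin m → ℕ
    cutInd e with label P (proj₁ (ends e)) ≟ᶠ label P (proj₂ (ends e))
    ... | yes _ = 0
    ... | no  _ = 1

  ℕtoℚ : ℕ → ℚ
  ℕtoℚ j = + j / 1

  -- Adm(Φ): η ≥ 0 and (1/(k_P-1)) Σ_{e∈E_P} η(e) ≥ 1 for every feasible P
  -- (written equivalently as Σ_{e∈E_P} η(e) ≥ k_P - 1, since k_P ≥ 2).
  Admissible : (Fin m → ℚ) → Set
  Admissible η = (∀ e → 0ℚ ≤ η e) × (∀ P → ℕtoℚ (k P ∸ 1) ≤ cutSum P η)

  energy : (Fin m → ℚ) → ℚ
  energy η = sumℚ λ e → η e * η e

  IsOptimalDensity : (Fin m → ℚ) → Set
  IsOptimalDensity η = Admissible η × (∀ ξ → Admissible ξ → energy η ≤ energy ξ)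

  IsBeurling : (Fin m → ℚ) → FeasiblePartition → Set
  IsBeurling η P = cutSum P η ≡ ℕtoℚ (k P ∸ 1)

  InEmax : (Fin m → ℚ) → Fin m → Set
  InEmax η e = ∀ e' → η e' ≤ η e

  -- critical partition: |E_P|/(k_P-1) ≤ |E_Q|/(k_Q-1) for all feasible Q
  -- (cross-multiplied, both denominators positive)
  IsCritical : FeasiblePartition → Set
  IsCritical P = ∀ Q → cutSize P ℕ.* (k Q ∸ 1) ℕ.≤ cutSize Q ℕ.* (k P ∸ 1)

  FinerThan : FeasiblePartition → FeasiblePartition → Set
  FinerThan P P' = ∀ u v → label P u ≡ label P v → label P' u ≡ label P' v

{-# OPTIONS --safe #-}
module Submission where

open import Defs
open import Data.Rational using (ℚ)
open import Data.Fin using (Fin)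
open import Function.Bundles using (_⇔_)

open import Data.Nat as ℕ using (ℕ; zero; suc; _∸_)
open import Data.Integer as ℤ using (+_)
import Data.Integer.Properties as ℤ
import Data.Nat.Coprimality as Coprime
open import Data.Rational using (0ℚ; _+_; _*_; _/_; _≤_; _<_; _≤?_; mkℚ; Positive; *≤*)
open import Data.Rational.Properties
open import Data.Fin using (zero; suc)
open import Data.Fin.Properties using (any?) renaming (_≟_ to _≟ᶠ_)
open import Data.Product using (_,_; proj₁; proj₂; ∃)
open import Data.Sum using (inj₁; inj₂)
open import Data.Empty using (⊥-elim)
open import Function using (_∘_; id)
open import Function.Bundles using (Equivalence; mk⇔)
open import Relation.Nullary using (yes; no; Dec)
open import Relation.Nullary.Decidable using (¬?; decidable-stable)
open import Relation.Binary.PropositionalEquality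

-- Let M be the maximum of η. Every edge of E_max carries M, so the Beurling property of Pmax
-- reads k_max − 1 = M |E_max| with E_max nonempty, i.e. M = (k_max − 1)/|E_max|. Criticality of P
-- gives |E_P|/(k_P − 1) ≤ |E_max|/(k_max − 1), i.e. M |E_P| ≤ k_P − 1 ≤ Σ_{E_P} η by
-- admissibility. As η ≤ M everywhere, every edge of E_P carries M, so E_P ⊆ E_max = E_Pmax;
-- since the parts of Pmax are connected, each lies inside a part of P.

module _ (G : Multigraph) where
  open Multigraph G

  ℕtoℚ≡mkℚ : ∀ j → ℕtoℚ G j ≡ mkℚ (+ j) 0 (Coprime.sym (Coprime.1-coprimeTo j))
  ℕtoℚ≡mkℚ j = normalize-coprime (Coprime.sym (Coprime.1-coprimeTo j))

  ℕtoℚ-+ : ∀ x y → ℕtoℚ G (x ℕ.+ y) ≡ ℕtoℚ G x + ℕtoℚ G y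
  ℕtoℚ-+ x y rewrite ℕtoℚ≡mkℚ x | ℕtoℚ≡mkℚ y =
    cong (_/ 1) (trans (ℤ.pos-+ x y)
      (sym (cong₂ ℤ._+_ (ℤ.*-identityʳ (+ x)) (ℤ.*-identityʳ (+ y)))))

  ℕtoℚ-* : ∀ x y → ℕtoℚ G (x ℕ.* y) ≡ ℕtoℚ G x * ℕtoℚ G y
  ℕtoℚ-* x y rewrite ℕtoℚ≡mkℚ x | ℕtoℚ≡mkℚ y = cong (_/ 1) (ℤ.pos-* x y)

  ℕtoℚ-mono-≤ : ∀ {x y} → x ℕ.≤ y → ℕtoℚ G x ≤ ℕtoℚ G y
  ℕtoℚ-mono-≤ {x} {y} x≤y rewrite ℕtoℚ≡mkℚ x | ℕtoℚ≡mkℚ y =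
    *≤* (subst₂ ℤ._≤_ (sym (ℤ.*-identityʳ (+ x))) (sym (ℤ.*-identityʳ (+ y))) (ℤ.+≤+ x≤y))

  ℕtoℚ-positive : ∀ j → Positive (ℕtoℚ G (suc j))
  ℕtoℚ-positive j = subst Positive (sym (ℕtoℚ≡mkℚ (suc j))) _

  sumℚ-cong : ∀ {j} {f g : Fin j → ℚ} → (∀ i → f i ≡ g i) → sumℚ G f ≡ sumℚ G g
  sumℚ-cong {zero}  f≡g = refl
  sumℚ-cong {suc j} f≡g = cong₂ _+_ (f≡g zero) (sumℚ-cong (f≡g ∘ suc))

  sumℕ-cong : ∀ {j} {f g : Fin j → ℕ} → (∀ i → f i ≡ g i) → sumℕ G f ≡ sumℕ G g
  sumℕ-cong {zero}  f≡g = refl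
  sumℕ-cong {suc j} f≡g = cong₂ ℕ._+_ (f≡g zero) (sumℕ-cong (f≡g ∘ suc))

  sumℚ-mono-≤ : ∀ {j} {f g : Fin j → ℚ} → (∀ i → f i ≤ g i) → sumℚ G f ≤ sumℚ G g
  sumℚ-mono-≤ {zero}  f≤g = ≤-refl
  sumℚ-mono-≤ {suc j} f≤g = +-mono-≤ (f≤g zero) (sumℚ-mono-≤ (f≤g ∘ suc))

  sumℚ-mono-< : ∀ {j} {f g : Fin j → ℚ} → (∀ i → f i ≤ g i) →
                ∀ i → f i < g i → sumℚ G f < sumℚ G g
  sumℚ-mono-< f≤g zero    fi<gi = +-mono-<-≤ fi<gi (sumℚ-mono-≤ (f≤g ∘ suc))
  sumℚ-mono-< f≤g (suc i) fi<gi = +-mono-≤-< (f≤g zero) (sumℚ-mono-< (f≤g ∘ suc) i fi<gi)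

  sumℚ-*-ℕtoℚ : ∀ {j} M (g : Fin j → ℕ) →
                sumℚ G (λ i → M * ℕtoℚ G (g i)) ≡ M * ℕtoℚ G (sumℕ G g)
  sumℚ-*-ℕtoℚ {zero}  M g = sym (*-zeroʳ M)
  sumℚ-*-ℕtoℚ {suc j} M g = begin
    M * ℕtoℚ G (g zero) + sumℚ G (λ i → M * ℕtoℚ G (g (suc i)))
      ≡⟨ cong (_+_ (M * ℕtoℚ G (g zero))) (sumℚ-*-ℕtoℚ M (g ∘ suc)) ⟩
    M * ℕtoℚ G (g zero) + M * ℕtoℚ G (sumℕ G (g ∘ suc))
      ≡⟨ sym (*-distribˡ-+ M _ _) ⟩
    M * (ℕtoℚ G (g zero) + ℕtoℚ G (sumℕ G (g ∘ suc)))
      ≡⟨ cong (M *_) (sym (ℕtoℚ-+ (g zero) _)) ⟩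
    M * ℕtoℚ G (g zero ℕ.+ sumℕ G (g ∘ suc)) ∎
    where open ≡-Reasoning

  InCut? : ∀ (P : FeasiblePartition G) e → Dec (InCut G P e)
  InCut? P e = ¬? (label P (proj₁ (ends e)) ≟ᶠ label P (proj₂ (ends e)))

  InCut⇔≢ : ∀ (P : FeasiblePartition G) e {x y} → Joins G e x y →
            InCut G P e ⇔ (label P x ≢ label P y)
  InCut⇔≢ P e (inj₁ refl) = mk⇔ id id
  InCut⇔≢ P e (inj₂ refl) = mk⇔ (_∘ sym) (_∘ sym)

  cutTerm : FeasiblePartition G → (Fin m → ℚ) → Fin m → ℚ
  cutTerm P η e with label P (proj₁ (ends e)) ≟ᶠ label P (proj₂ (ends e))
  ... | yes _ = 0ℚ
  ... | no  _ = η e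

  cutIndicator : FeasiblePartition G → Fin m → ℕ
  cutIndicator P e with label P (proj₁ (ends e)) ≟ᶠ label P (proj₂ (ends e))
  ... | yes _ = 0
  ... | no  _ = 1

  -- The summands of cutSum and cutSize are local to their where blocks in Defs; the `_` in
  -- each pointwise lemma is solved from its use in the sum and so names that summand.
  mutual
    cutSum≡sumℚ-cutTerm : ∀ (P : FeasiblePartition G) η → cutSum G P η ≡ sumℚ G (cutTerm P η)
    cutSum≡sumℚ-cutTerm P η = sumℚ-cong (cutSum-summand P η)

    cutSum-summand : ∀ (P : FeasiblePartition G) η e → _ ≡ cutTerm P η e
    cutSum-summand P η e with label P (proj₁ (ends e)) ≟ᶠ label P (proj₂ (ends e))
    ... | yes _ = refl
    ... | no  _ = refl

  mutual
    cutSize≡sumℕ-cutIndicator : ∀ (P : FeasiblePartition G) →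
                                cutSize G P ≡ sumℕ G (cutIndicator P)
    cutSize≡sumℕ-cutIndicator P = sumℕ-cong (cutSize-summand P)

    cutSize-summand : ∀ (P : FeasiblePartition G) e → _ ≡ cutIndicator P e
    cutSize-summand P e with label P (proj₁ (ends e)) ≟ᶠ label P (proj₂ (ends e))
    ... | yes _ = refl
    ... | no  _ = refl

  module _ (P : FeasiblePartition G) (η : Fin m → ℚ) (M : ℚ) where

    cutTerm-≤ : ∀ e → (InCut G P e → η e ≤ M) → cutTerm P η e ≤ M * ℕtoℚ G (cutIndicator P e)
    cutTerm-≤ e ηe≤M with label P (proj₁ (ends e)) ≟ᶠ label P (proj₂ (ends e))
    ... | yes _   = ≤-reflexive (sym (*-zeroʳ M))
    ... | no  cut = subst (η e ≤_) (sym (*-identityʳ M)) (ηe≤M cut)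

    cutTerm-< : ∀ e → InCut G P e → η e < M → cutTerm P η e < M * ℕtoℚ G (cutIndicator P e)
    cutTerm-< e cut ηe<M with label P (proj₁ (ends e)) ≟ᶠ label P (proj₂ (ends e))
    ... | yes same = ⊥-elim (cut same)
    ... | no  _    = subst (η e <_) (sym (*-identityʳ M)) ηe<M

    cutTerm-≡ : ∀ e → (InCut G P e → η e ≡ M) → cutTerm P η e ≡ M * ℕtoℚ G (cutIndicator P e)
    cutTerm-≡ e ηe≡M with label P (proj₁ (ends e)) ≟ᶠ label P (proj₂ (ends e))
    ... | yes _   = sym (*-zeroʳ M)
    ... | no  cut = trans (ηe≡M cut) (sym (*-identityʳ M))

    sumℚ-M*cutIndicator :
      sumℚ G (λ e → M * ℕtoℚ G (cutIndicator P e)) ≡ M * ℕtoℚ G (cutSize G P)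
    sumℚ-M*cutIndicator = trans (sumℚ-*-ℕtoℚ M (cutIndicator P))
      (cong (λ s → M * ℕtoℚ G s) (sym (cutSize≡sumℕ-cutIndicator P)))

    cutSum-< : (∀ e → InCut G P e → η e ≤ M) → ∀ e → InCut G P e → η e < M →
               cutSum G P η < M * ℕtoℚ G (cutSize G P)
    cutSum-< η≤M e cut ηe<M = subst₂ _<_ (sym (cutSum≡sumℚ-cutTerm P η)) sumℚ-M*cutIndicator
      (sumℚ-mono-< (λ e → cutTerm-≤ e (η≤M e)) e (cutTerm-< e cut ηe<M))

    cutSum-const : (∀ e → InCut G P e → η e ≡ M) → cutSum G P η ≡ M * ℕtoℚ G (cutSize G P)
    cutSum-const η≡M = trans (cutSum≡sumℚ-cutTerm P η)
      (trans (sumℚ-cong (λ e → cutTerm-≡ e (η≡M e))) sumℚ-M*cutIndicator)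

    cutEdges-tight : (∀ e → InCut G P e → η e ≤ M) → M * ℕtoℚ G (cutSize G P) ≤ cutSum G P η →
                     ∀ e → InCut G P e → M ≤ η e
    cutEdges-tight η≤M M|E|≤cutSum e cut with M ≤? η e
    ... | yes M≤ηe = M≤ηe
    ... | no  M≰ηe =
      ⊥-elim (<-irrefl refl (<-≤-trans (cutSum-< η≤M e cut (≰⇒> M≰ηe)) M|E|≤cutSum))

  0<k∸1 : ∀ (P : FeasiblePartition G) → 0ℚ < ℕtoℚ G (k P ∸ 1)
  0<k∸1 P with k P | two≤k P
  ... | suc zero    | ℕ.s≤s ()
  ... | suc (suc j) | _ = positive⁻¹ _ {{ℕtoℚ-positive j}}

  Beurling⇒cut-nonempty : ∀ η (P : FeasiblePartition G) → IsBeurling G η P → ∃ (InCut G P)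
  Beurling⇒cut-nonempty η P beurling with any? (InCut? P)
  ... | yes cut   = cut
  ... | no  noCut = ⊥-elim (<-irrefl (sym k∸1≡0) (0<k∸1 P))
    where
    open ≡-Reasoning
    k∸1≡0 : ℕtoℚ G (k P ∸ 1) ≡ 0ℚ
    k∸1≡0 = begin
      ℕtoℚ G (k P ∸ 1)             ≡⟨ sym beurling ⟩
      cutSum G P η                 ≡⟨ cutSum-const P η 0ℚ (λ e cut → ⊥-elim (noCut (e , cut))) ⟩
      0ℚ * ℕtoℚ G (cutSize G P)    ≡⟨ *-zeroˡ (ℕtoℚ G (cutSize G P)) ⟩
      0ℚ                           ∎

  ratio-bound : ∀ a b c d M → 0ℚ < ℕtoℚ G c → ℕtoℚ G c ≡ M * ℕtoℚ G d →
                b ℕ.* c ℕ.≤ d ℕ.* a → M * ℕtoℚ G b ≤ ℕtoℚ G a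
  ratio-bound a b c zero    M c>0 c≡M*0 _ = ⊥-elim (<-irrefl (sym (trans c≡M*0 (*-zeroʳ M))) c>0)
  ratio-bound a b c (suc d) M _   c≡M*D bc≤da =
    *-cancelˡ-≤-pos D {{ℕtoℚ-positive d}} (begin
      D * (M * B)          ≡⟨ sym (*-assoc D M B) ⟩
      D * M * B            ≡⟨ cong (_* B) (trans (*-comm D M) (sym c≡M*D)) ⟩
      C * B                ≡⟨ *-comm C B ⟩
      B * C                ≡⟨ sym (ℕtoℚ-* b c) ⟩
      ℕtoℚ G (b ℕ.* c)     ≤⟨ ℕtoℚ-mono-≤ bc≤da ⟩
      ℕtoℚ G (suc d ℕ.* a) ≡⟨ ℕtoℚ-* (suc d) a ⟩
      D * A                ∎)
    where
    open ≤-Reasoning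
    A B C D : ℚ
    A = ℕtoℚ G a
    B = ℕtoℚ G b
    C = ℕtoℚ G c
    D = ℕtoℚ G (suc d)

  critical⇒cutSize-bound : ∀ P Q M → IsCritical G P →
    ℕtoℚ G (k Q ∸ 1) ≡ M * ℕtoℚ G (cutSize G Q) → M * ℕtoℚ G (cutSize G P) ≤ ℕtoℚ G (k P ∸ 1)
  critical⇒cutSize-bound P Q M critical c≡M*d =
    ratio-bound (k P ∸ 1) (cutSize G P) (k Q ∸ 1) (cutSize G Q) M (0<k∸1 Q) c≡M*d (critical Q)

  cut⊆⇒finer : ∀ (P Q : FeasiblePartition G) →
               (∀ e → InCut G Q e → InCut G P e) → FinerThan G P Q
  cut⊆⇒finer P Q cutQ⊆cutP u v Pu≡Pv = walk refl (partConn P (label P u) u v refl (sym Pu≡Pv))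
    where
    edge : ∀ e {x y} → Joins G e x y → label P x ≡ label P y → label Q x ≡ label Q y
    edge e {x} {y} j Px≡Py = decidable-stable (label Q x ≟ᶠ label Q y) λ Qx≢Qy →
      Equivalence.to (InCut⇔≢ P e j) (cutQ⊆cutP e (Equivalence.from (InCut⇔≢ Q e j) Qx≢Qy)) Px≡Py
    walk : ∀ {i x y} → label P x ≡ i → WalkIn G (λ w → label P w ≡ i) x y → label Q x ≡ label Q y
    walk _    here                = refl
    walk Px≡i (step e j Pw≡i w⇝y) = trans (edge e j (trans Px≡i (sym Pw≡i))) (walk Pw≡i w⇝y)

mainTheorem10 : (G : Multigraph) → Connected G →
    (η : Fin (Multigraph.m G) → ℚ) → IsOptimalDensity G η →
    (Pmax : FeasiblePartition G) → IsBeurling G η Pmax →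
    (∀ e → InCut G Pmax e ⇔ InEmax G η e) →
    (P : FeasiblePartition G) → IsCritical G P →
    FinerThan G Pmax P
mainTheorem10 G _ η ((_ , admissible) , _) Pmax beurling cut⇔max P critical =
  cut⊆⇒finer G Pmax P cutP⊆cutPmax
  where
  cut₀ : ∃ (InCut G Pmax)
  cut₀ = Beurling⇒cut-nonempty G η Pmax beurling

  M : ℚ
  M = η (proj₁ cut₀)

  η≤M : ∀ e → η e ≤ M
  η≤M = Equivalence.to (cut⇔max (proj₁ cut₀)) (proj₂ cut₀)

  cutPmax-at-M : ∀ e → InCut G Pmax e → η e ≡ M
  cutPmax-at-M e cut = ≤-antisym (η≤M e) (Equivalence.to (cut⇔max e) cut (proj₁ cut₀))

  M|E_P|≤cutSum : M * ℕtoℚ G (cutSize G P) ≤ cutSum G P η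
  M|E_P|≤cutSum = ≤-trans (critical⇒cutSize-bound G P Pmax M critical
    (trans (sym beurling) (cutSum-const G Pmax η M cutPmax-at-M))) (admissible P)

  cutP⊆cutPmax : ∀ e → InCut G P e → InCut G Pmax e
  cutP⊆cutPmax e cut = Equivalence.from (cut⇔max e) λ e' →
    ≤-trans (η≤M e') (cutEdges-tight G P η M (λ e _ → η≤M e) M|E_P|≤cutSum e cut)
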